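{- For every graph $G$ and every 2-switch $\tau$ on $G$, $|\chi(\tau(G))-\chi(G)|\le 1$, where $\chi$ denotes the chromatic number.
   Context: Graphs are finite and simple. A 2-switch on $G$ is specified by four distinct vertices $a,b,c,d$ with $ab,cd\in E(G)$ and $ac,bd\notin E(G)$; it produces $\tau(G)=G-ab-cd+ac+bd$. $\chi(G)$ is the least $k$ such that $G$ admits a proper vertex coloring with $k$ colors. -}

module Defs where

open import Data.Nat using (ℕ; _<_)
open import Data.Fin using (Fin)
open import Data.Bool using (Bool; true; false)
open import Data.Product using (_×_; Σ; _,_)
open import Relation.Binary.PropositionalEquality using (_≡_; _≢_)
open import Relation.Nullary using (¬_)
open import Relation.Nullary.Decidable using (⌊_⌋)
open import Data.Fin using (_≟_)
open import Data.Bool using (_∧_; _∨_; if_then_else_)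

record Graph (n : ℕ) : Set where
  field
    adj   : Fin n → Fin n → Bool
    sym   : ∀ u v → adj u v ≡ adj v u
    irrefl : ∀ v → adj v v ≡ false
open Graph public

Edge : ∀ {n} → Graph n → Fin n → Fin n → Set
Edge G u v = adj G u v ≡ true

NonEdge : ∀ {n} → Graph n → Fin n → Fin n → Set
NonEdge G u v = adj G u v ≡ false

record TwoSwitch {n : ℕ} (G : Graph n) : Set where
  field
    a b c d : Fin n
    a≢b : a ≢ b
    a≢c : a ≢ c
    a≢d : a ≢ d
    b≢c : b ≢ c
    b≢d : b ≢ d
    c≢d : c ≢ d
    ab∈E : Edge G a b
    cd∈E : Edge G c d
    ac∉E : NonEdge G a c
    bd∉E : NonEdge G b d
open TwoSwitch public

samePair : ∀ {n} → Fin n → Fin n → Fin n → Fin n → Bool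
samePair u v x y = (⌊ u ≟ x ⌋ ∧ ⌊ v ≟ y ⌋) ∨ (⌊ u ≟ y ⌋ ∧ ⌊ v ≟ x ⌋)

switchAdj : ∀ {n} (G : Graph n) → TwoSwitch G → Fin n → Fin n → Bool
switchAdj G τ u v =
  if samePair u v (a τ) (c τ) ∨ samePair u v (b τ) (d τ) then true
  else if samePair u v (a τ) (b τ) ∨ samePair u v (c τ) (d τ) then false
  else adj G u v


ProperColoring : ∀ {n} → (Fin n → Fin n → Bool) → (k : ℕ) → (Fin n → Fin k) → Set
ProperColoring A k f = ∀ u v → A u v ≡ true → f u ≢ f v

Colorable : ∀ {n} → (Fin n → Fin n → Bool) → ℕ → Set
Colorable A k = Σ (Fin _ → Fin k) (ProperColoring A k)

IsChromaticNumber : ∀ {n} → (Fin n → Fin n → Bool) → ℕ → Set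
IsChromaticNumber A k = Colorable A k × (∀ j → j < k → ¬ Colorable A j)

{-# OPTIONS --safe #-}
-- Every edge of τ(G) that is not an edge of G meets {a, b}, a pair that is
-- independent in τ(G); every edge of G that is not an edge of τ(G) meets
-- {a, c}, a pair that is independent in G. Giving such a pair one fresh
-- colour turns a k-colouring of either graph into a (k+1)-colouring of the
-- other, so the two chromatic numbers differ by at most one.
module Submission where

open import Defs hiding (sym)
open import Data.Bool using (Bool; true; false; _∧_; _∨_; if_then_else_)
open import Data.Bool.Properties using (∧-comm; ∨-comm)
open import Data.Fin using (Fin; _≟_; fromℕ; inject₁)
open import Data.Fin.Properties using (fromℕ≢inject₁; inject₁-injective)
open import Data.Nat using (ℕ; suc; _≤_)
open import Data.Nat.Properties using (≮⇒≥)
open import Data.Product using (_×_; _,_; proj₁)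
open import Data.Sum using (_⊎_; inj₁; inj₂)
import Data.Sum as Sum
open import Function using (_∘_)
open import Level using (0ℓ)
open import Relation.Binary.PropositionalEquality
  using (_≡_; _≢_; refl; sym; trans; cong₂; subst)
open import Relation.Nullary using (Dec; does; proof; yes; no; ¬_; contradiction; Reflects; invert)
open import Relation.Nullary.Decidable using (⌊_⌋; isYes≗does; dec-true; dec-false; _×-dec_; _⊎-dec_)
open import Relation.Unary using (Pred; Decidable; _∈_; ｛_｝; _∪_)
open import Relation.Unary.Properties using (_∪?_)

module _ {n : ℕ} where

  Independent : (Fin n → Fin n → Bool) → Pred (Fin n) 0ℓ → Set
  Independent A S = ∀ {u v} → u ∈ S → v ∈ S → A u v ≡ false

  recolor : ∀ {k} {S : Pred (Fin n) 0ℓ} → Decidable S → (Fin n → Fin k) → Fin n → Fin (suc k)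
  recolor {k} S? f u with S? u
  ... | yes _ = fromℕ k
  ... | no _  = inject₁ (f u)

  colorable-suc : ∀ {k} {A A′ : Fin n → Fin n → Bool} {S : Pred (Fin n) 0ℓ} →
                  Decidable S → Independent A′ S →
                  (∀ u v → A′ u v ≡ true → A u v ≡ true ⊎ u ∈ S ⊎ v ∈ S) →
                  Colorable A k → Colorable A′ (suc k)
  colorable-suc {k} {A} {A′} S? indep new (f , proper) = recolor S? f , proper′
    where
    proper′ : ProperColoring A′ (suc k) (recolor S? f)
    proper′ u v uv with S? u | S? v | new u v uv
    ... | yes u∈S | yes v∈S | _ with trans (sym uv) (indep u∈S v∈S)
    ...   | ()
    proper′ u v uv | yes _   | no _    | _ = fromℕ≢inject₁
    proper′ u v uv | no _    | yes _   | _ = fromℕ≢inject₁ ∘ sym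
    proper′ u v uv | no _    | no _    | inj₁ uv∈A = proper u v uv∈A ∘ inject₁-injective
    proper′ u v uv | no u∉S  | no _    | inj₂ (inj₁ u∈S) = contradiction u∈S u∉S
    proper′ u v uv | no _    | no v∉S  | inj₂ (inj₂ v∈S) = contradiction v∈S v∉S

chromatic-≤ : ∀ {n} {A : Fin n → Fin n → Bool} {k m} →
              IsChromaticNumber A k → Colorable A m → k ≤ m
chromatic-≤ (_ , minimal) colorable = ≮⇒≥ (λ m<k → minimal _ m<k colorable)

pair-independent : ∀ {n} (H : Graph n) {x y} → NonEdge H x y → Independent (adj H) (｛ x ｝ ∪ ｛ y ｝)
pair-independent H xy (inj₁ refl) (inj₁ refl) = irrefl H _
pair-independent H xy (inj₁ refl) (inj₂ refl) = xy
pair-independent H xy (inj₂ refl) (inj₁ refl) = trans (Graph.sym H _ _) xy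
pair-independent H xy (inj₂ refl) (inj₂ refl) = irrefl H _

module _ {n : ℕ} where

  SamePair : Fin n → Fin n → Fin n → Fin n → Set
  SamePair u v x y = (u ≡ x × v ≡ y) ⊎ (u ≡ y × v ≡ x)

  samePair? : ∀ (u v x y : Fin n) → Dec (SamePair u v x y)
  samePair? u v x y = (u ≟ x ×-dec v ≟ y) ⊎-dec (u ≟ y ×-dec v ≟ x)

  samePair≡does : ∀ (u v x y : Fin n) → samePair u v x y ≡ does (samePair? u v x y)
  samePair≡does u v x y = cong₂ _∨_ (cong₂ _∧_ (isYes≗does (u ≟ x)) (isYes≗does (v ≟ y)))
                                    (cong₂ _∧_ (isYes≗does (u ≟ y)) (isYes≗does (v ≟ x)))

  samePair-true⇒ : ∀ {u v x y : Fin n} → samePair u v x y ≡ true → SamePair u v x y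
  samePair-true⇒ {u} {v} {x} {y} eq =
    invert (subst (Reflects _) (trans (sym (samePair≡does u v x y)) eq) (proof (samePair? u v x y)))

  samePair-false : ∀ (u v x y : Fin n) → ¬ SamePair u v x y → samePair u v x y ≡ false
  samePair-false u v x y ¬uv=xy =
    trans (samePair≡does u v x y) (dec-false (samePair? u v x y) ¬uv=xy)

  samePair-refl : ∀ (x y : Fin n) → samePair x y x y ≡ true
  samePair-refl x y = trans (samePair≡does x y x y) (dec-true (samePair? x y x y) (inj₁ (refl , refl)))

  samePair-comm : ∀ (u v x y : Fin n) → samePair u v x y ≡ samePair v u x y
  samePair-comm u v x y = trans (∨-comm (⌊ u ≟ x ⌋ ∧ ⌊ v ≟ y ⌋) (⌊ u ≟ y ⌋ ∧ ⌊ v ≟ x ⌋))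
                                (cong₂ _∨_ (∧-comm ⌊ u ≟ y ⌋ ⌊ v ≟ x ⌋) (∧-comm ⌊ u ≟ x ⌋ ⌊ v ≟ y ⌋))

  samePair-diag : ∀ (u : Fin n) {x y} → x ≢ y → samePair u u x y ≡ false
  samePair-diag u {x} {y} x≢y = samePair-false u u x y λ where
    (inj₁ (refl , refl)) → x≢y refl
    (inj₂ (refl , refl)) → x≢y refl

  samePair⇒meets : ∀ {u v x y : Fin n} → samePair u v x y ≡ true → x ≡ u ⊎ x ≡ v
  samePair⇒meets eq with samePair-true⇒ eq
  ... | inj₁ (u≡x , _) = inj₁ (sym u≡x)
  ... | inj₂ (_ , v≡x) = inj₂ (sym v≡x)

module _ {n : ℕ} (G : Graph n) (τ : TwoSwitch G) where

  switchAdj-cong : ∀ u v {p q r s x} →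
                   samePair u v (a τ) (c τ) ≡ p → samePair u v (b τ) (d τ) ≡ q →
                   samePair u v (a τ) (b τ) ≡ r → samePair u v (c τ) (d τ) ≡ s → adj G u v ≡ x →
                   switchAdj G τ u v ≡ (if p ∨ q then true else if r ∨ s then false else x)
  switchAdj-cong u v refl refl refl refl refl = refl

  switched : Graph n
  switched = record { adj = switchAdj G τ ; sym = switchAdj-sym ; irrefl = switchAdj-irrefl }
    where
    switchAdj-sym : ∀ u v → switchAdj G τ u v ≡ switchAdj G τ v u
    switchAdj-sym u v = switchAdj-cong u v (samePair-comm u v (a τ) (c τ)) (samePair-comm u v (b τ) (d τ))
                                       (samePair-comm u v (a τ) (b τ)) (samePair-comm u v (c τ) (d τ))
                                       (Graph.sym G u v)

    switchAdj-irrefl : ∀ u → switchAdj G τ u u ≡ false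
    switchAdj-irrefl u = switchAdj-cong u u (samePair-diag u (a≢c τ)) (samePair-diag u (b≢d τ))
                                        (samePair-diag u (a≢b τ)) (samePair-diag u (c≢d τ))
                                        (irrefl G u)

  switched-nonEdge-ab : NonEdge switched (a τ) (b τ)
  switched-nonEdge-ab = switchAdj-cong (a τ) (b τ) (samePair-false (a τ) (b τ) (a τ) (c τ) ab≢ac)
                                       (samePair-false (a τ) (b τ) (b τ) (d τ) ab≢bd)
                                       (samePair-refl (a τ) (b τ)) refl refl
    where
    ab≢ac : ¬ SamePair (a τ) (b τ) (a τ) (c τ)
    ab≢ac (inj₁ (_ , b≡c)) = b≢c τ b≡c
    ab≢ac (inj₂ (a≡c , _)) = a≢c τ a≡c

    ab≢bd : ¬ SamePair (a τ) (b τ) (b τ) (d τ)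
    ab≢bd (inj₁ (a≡b , _)) = a≢b τ a≡b
    ab≢bd (inj₂ (a≡d , _)) = a≢d τ a≡d

  switched-edge : ∀ u v → Edge switched u v →
                  Edge G u v ⊎ samePair u v (a τ) (c τ) ≡ true ⊎ samePair u v (b τ) (d τ) ≡ true
  switched-edge u v uv
    with samePair u v (a τ) (c τ) | samePair u v (b τ) (d τ)
       | samePair u v (a τ) (b τ) ∨ samePair u v (c τ) (d τ)
  ... | true  | _     | _     = inj₂ (inj₁ refl)
  ... | false | true  | _     = inj₂ (inj₂ refl)
  ... | false | false | false = inj₁ uv

  edge-switched : ∀ u v → Edge G u v →
                  Edge switched u v ⊎ samePair u v (a τ) (b τ) ≡ true ⊎ samePair u v (c τ) (d τ) ≡ true
  edge-switched u v uv
    with samePair u v (a τ) (c τ) ∨ samePair u v (b τ) (d τ)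
       | samePair u v (a τ) (b τ) | samePair u v (c τ) (d τ)
  ... | true  | _     | _     = inj₁ refl
  ... | false | true  | _     = inj₂ (inj₁ refl)
  ... | false | false | true  = inj₂ (inj₂ refl)
  ... | false | false | false = inj₁ uv

  switched-colorable : ∀ {k} → Colorable (adj G) k → Colorable (adj switched) (suc k)
  switched-colorable =
    colorable-suc (_≟_ (a τ) ∪? _≟_ (b τ)) (pair-independent switched switched-nonEdge-ab) new-edge
    where
    new-edge : ∀ u v → Edge switched u v →
               Edge G u v ⊎ u ∈ ｛ a τ ｝ ∪ ｛ b τ ｝ ⊎ v ∈ ｛ a τ ｝ ∪ ｛ b τ ｝
    new-edge u v uv with switched-edge u v uv
    ... | inj₁ uv∈G        = inj₁ uv∈G
    ... | inj₂ (inj₁ uv=ac) = inj₂ (Sum.map inj₁ inj₁ (samePair⇒meets uv=ac))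
    ... | inj₂ (inj₂ uv=bd) = inj₂ (Sum.map inj₂ inj₂ (samePair⇒meets uv=bd))

  colorable-of-switched : ∀ {k} → Colorable (adj switched) k → Colorable (adj G) (suc k)
  colorable-of-switched =
    colorable-suc (_≟_ (a τ) ∪? _≟_ (c τ)) (pair-independent G (ac∉E τ)) removed-edge
    where
    removed-edge : ∀ u v → Edge G u v →
                   Edge switched u v ⊎ u ∈ ｛ a τ ｝ ∪ ｛ c τ ｝ ⊎ v ∈ ｛ a τ ｝ ∪ ｛ c τ ｝
    removed-edge u v uv with edge-switched u v uv
    ... | inj₁ uv∈τG        = inj₁ uv∈τG
    ... | inj₂ (inj₁ uv=ab) = inj₂ (Sum.map inj₁ inj₁ (samePair⇒meets uv=ab))
    ... | inj₂ (inj₂ uv=cd) = inj₂ (Sum.map inj₂ inj₂ (samePair⇒meets uv=cd))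

mainTheorem18 : ∀ {n} (G : Graph n) (τ : TwoSwitch G) (k k′ : ℕ) →
                IsChromaticNumber (adj G) k →
                IsChromaticNumber (switchAdj G τ) k′ →
                (k ≤ suc k′) × (k′ ≤ suc k)
mainTheorem18 G τ k k′ χG χτG =
  chromatic-≤ χG (colorable-of-switched G τ (proj₁ χτG)) ,
  chromatic-≤ χτG (switched-colorable G τ (proj₁ χG))
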